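{- If $G$ is a bipartite graph with bipartition $U\cup V$, then $W_\sigma(G)\ge|U||V|$ for every signing $\sigma$ of $G$.
   Context: A signing of $G$ is a map $\sigma:E(G)\to\{\pm1\}$; for a path $P$, $\sigma(P)=\sum_{e\in P}\sigma(e)$; $d_\sigma(u,v)=\min_P|\sigma(P)|$ over all $uv$-paths $P$ in $G$, with the convention $d_\sigma(u,v)=\infty$ if $u,v$ lie in different components and $d_\sigma(u,u)=0$; and $W_\sigma(G)=\frac12\sum_{u,v\in V(G)}d_\sigma(u,v)$. -}

module Defs where

open import Data.Nat using (ℕ; zero; suc; _+_; _*_; _≤_; _⊓_; _/_)
open import Data.Fin using (Fin; _≟_)
open import Data.Bool using (Bool; true; false; _∧_; _∨_; not; if_then_else_)
open import Data.List using (List; []; _∷_; map; concatMap; foldr; length; upTo; allFin; filterᵇ)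
open import Data.Bool.ListAction using (any)
open import Data.Integer as ℤ using (ℤ; ∣_∣)
open import Data.Sign using (Sign)
open import Data.Unit using (⊤)
open import Data.Empty using (⊥)
open import Relation.Nullary using (¬_)
open import Relation.Nullary.Decidable using (⌊_⌋)
open import Relation.Binary.PropositionalEquality using (_≡_)

record Graph (n : ℕ) : Set where
  field
    adj    : Fin n → Fin n → Bool
    sym    : ∀ u v → adj u v ≡ adj v u
    irrefl : ∀ u → adj u u ≡ false
open Graph public

-- A signing: a sign for each edge (the value on an edge uv does not depend on orientation;
-- values on non-edges are irrelevant).
record Signing {n : ℕ} (G : Graph n) : Set where
  field
    sgn     : Fin n → Fin n → Sign
    sgn-sym : ∀ u v → adj G u v ≡ true → sgn u v ≡ sgn v u
open Signing public

signℤ : Sign → ℤ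
signℤ Sign.+ = ℤ.+ 1
signℤ Sign.- = ℤ.- (ℤ.+ 1)

-- extended naturals (∞ for disconnected pairs)
data ℕ∞ : Set where
  fin : ℕ → ℕ∞
  ∞   : ℕ∞

_+∞_ : ℕ∞ → ℕ∞ → ℕ∞
fin a +∞ fin b = fin (a + b)
_     +∞ _     = ∞

min∞ : ℕ∞ → ℕ∞ → ℕ∞
min∞ (fin a) (fin b) = fin (a ⊓ b)
min∞ (fin a) ∞       = fin a
min∞ ∞       y       = y

half∞ : ℕ∞ → ℕ∞
half∞ (fin a) = fin (a / 2)
half∞ ∞       = ∞

_≤∞_ : ℕ∞ → ℕ∞ → Set
fin a ≤∞ fin b = a ≤ b
_     ≤∞ ∞     = ⊤
∞     ≤∞ fin _ = ⊥

module _ {n : ℕ} (G : Graph n) where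

  elem : Fin n → List (Fin n) → Bool
  elem v xs = any (λ w → ⌊ w ≟ v ⌋) xs

  distinct : List (Fin n) → Bool
  distinct []       = true
  distinct (x ∷ xs) = not (elem x xs) ∧ distinct xs

  isWalk : List (Fin n) → Bool
  isWalk []           = true
  isWalk (x ∷ [])     = true
  isWalk (x ∷ y ∷ xs) = adj G x y ∧ isWalk (y ∷ xs)

  lastOr : Fin n → List (Fin n) → Fin n
  lastOr d []       = d
  lastOr d (x ∷ xs) = lastOr x xs

  isPath : Fin n → Fin n → List (Fin n) → Bool
  isPath u v []       = false
  isPath u v (x ∷ xs) = ⌊ x ≟ u ⌋ ∧ ⌊ lastOr x xs ≟ v ⌋ ∧ isWalk (x ∷ xs) ∧ distinct (x ∷ xs)

  listsOfLength : ℕ → List (List (Fin n))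
  listsOfLength zero    = [] ∷ []
  listsOfLength (suc k) = concatMap (λ xs → map (_∷ xs) (allFin n)) (listsOfLength k)

  -- all vertex lists of length ≤ n (every path has at most n vertices)
  candidates : List (List (Fin n))
  candidates = concatMap listsOfLength (upTo (suc n))

  module _ (σ : Signing G) where

    σP : List (Fin n) → ℤ
    σP []           = ℤ.+ 0
    σP (x ∷ [])     = ℤ.+ 0
    σP (x ∷ y ∷ xs) = signℤ (sgn σ x y) ℤ.+ σP (y ∷ xs)

    dσ : Fin n → Fin n → ℕ∞
    dσ u v = foldr (λ P acc → min∞ (fin ∣ σP P ∣) acc) ∞ (filterᵇ (isPath u v) candidates)

    Wσ : ℕ∞
    Wσ = half∞ (foldr _+∞_ (fin 0)
           (concatMap (λ u → map (λ v → dσ u v) (allFin n)) (allFin n)))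

-- sizes of the two sides of a bipartition given by part : Fin n → Bool (true ↦ U, false ↦ V)
sizeU : {n : ℕ} → (Fin n → Bool) → ℕ
sizeU {n} part = length (filterᵇ part (allFin n))

sizeV : {n : ℕ} → (Fin n → Bool) → ℕ
sizeV {n} part = length (filterᵇ (λ x → not (part x)) (allFin n))

IsBipartition : {n : ℕ} → Graph n → (Fin n → Bool) → Set
IsBipartition {n} G part = ∀ (u v : Fin n) → adj G u v ≡ true → ¬ (part u ≡ part v)

-- A path between the two sides of a bipartite graph has an odd number of edges, so its signed
-- length, a sum of an odd number of ±1's, is odd and in particular nonzero. Hence
-- d_σ(u,v) ≥ 1 for every u ∈ U, v ∈ V; such ordered pairs contribute at least 2|U||V| to the
-- sum over all ordered pairs, and halving gives W_σ(G) ≥ |U||V|.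
module Submission where

open import Defs hiding (sym)
open import Data.Nat using (ℕ; zero; suc; _+_; _*_; _≤_; _/_; z≤n; s≤s; parity)
open import Data.Nat.Properties as ℕ using (+-commutativeSemigroup)
open import Data.Nat.DivMod using (m*n/n≡m; /-monoˡ-≤)
open import Data.Nat.ListAction using (sum)
open import Data.Fin using (Fin; _≟_)
open import Data.Bool using (Bool; true; false; not; _xor_; if_then_else_)
open import Data.Bool.Properties using (xor-same)
open import Data.List using (List; []; _∷_; _++_; map; concatMap; foldr; length; allFin; filterᵇ)
open import Data.List.Properties using (map-cong)
open import Data.Integer as ℤ using (∣_∣)
open import Data.Sign using (Sign)
open import Data.Parity.Base as ℙ using (Parity; 0ℙ; 1ℙ; _⁻¹)
open import Data.Parity.Properties using (⁻¹-involutive; suc-homo-⁻¹; p+p≡0ℙ; p+p⁻¹≡1ℙ)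
open import Data.Unit using (tt)
open import Function using (_∘_)
open import Relation.Nullary using (yes)
open import Relation.Binary.PropositionalEquality
  using (_≡_; _≢_; refl; sym; trans; cong; cong₂; subst; module ≡-Reasoning)
open import Algebra.Properties.CommutativeSemigroup +-commutativeSemigroup using (x∙yz≈y∙xz)

0≤∞ : ∀ x → fin 0 ≤∞ x
0≤∞ (fin x) = z≤n
0≤∞ ∞       = tt

+∞-identityˡ : ∀ x → fin 0 +∞ x ≡ x
+∞-identityˡ (fin x) = refl
+∞-identityˡ ∞       = refl

+∞-assoc : ∀ x y z → (x +∞ y) +∞ z ≡ x +∞ (y +∞ z)
+∞-assoc (fin x) (fin y) (fin z) = cong fin (ℕ.+-assoc x y z)
+∞-assoc (fin x) (fin y) ∞       = refl
+∞-assoc (fin x) ∞       z       = refl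
+∞-assoc ∞       y       z       = refl

+∞-mono-≤∞ : ∀ {a b} x y → fin a ≤∞ x → fin b ≤∞ y → fin (a + b) ≤∞ (x +∞ y)
+∞-mono-≤∞ (fin x) (fin y) a≤x b≤y = ℕ.+-mono-≤ a≤x b≤y
+∞-mono-≤∞ (fin x) ∞       _   _   = tt
+∞-mono-≤∞ ∞       y       _   _   = tt

min∞-glb : ∀ {a} x y → fin a ≤∞ x → fin a ≤∞ y → fin a ≤∞ min∞ x y
min∞-glb (fin x) (fin y) a≤x a≤y = ℕ.⊓-glb a≤x a≤y
min∞-glb (fin x) ∞       a≤x _   = a≤x
min∞-glb ∞       y       _   a≤y = a≤y

≤∞-half∞ : ∀ m x → fin (m * 2) ≤∞ x → fin m ≤∞ half∞ x
≤∞-half∞ m (fin x) 2m≤x = subst (_≤ x / 2) (m*n/n≡m m 2) (/-monoˡ-≤ 2 2m≤x)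
≤∞-half∞ m ∞       _    = tt

sum∞ : List ℕ∞ → ℕ∞
sum∞ = foldr _+∞_ (fin 0)

sum∞-++ : ∀ xs ys → sum∞ (xs ++ ys) ≡ sum∞ xs +∞ sum∞ ys
sum∞-++ []       ys = sym (+∞-identityˡ (sum∞ ys))
sum∞-++ (x ∷ xs) ys = trans (cong (x +∞_) (sum∞-++ xs ys)) (sym (+∞-assoc x (sum∞ xs) (sum∞ ys)))

module _ {A : Set} where

  sum-≤∞-sum∞ : (g : A → ℕ) (f : A → ℕ∞) → (∀ a → fin (g a) ≤∞ f a) →
                ∀ xs → fin (sum (map g xs)) ≤∞ sum∞ (map f xs)
  sum-≤∞-sum∞ g f g≤f []       = z≤n
  sum-≤∞-sum∞ g f g≤f (x ∷ xs) = +∞-mono-≤∞ (f x) _ (g≤f x) (sum-≤∞-sum∞ g f g≤f xs)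

  sum-≤∞-sum∞-concatMap : (g : A → ℕ) (h : A → List ℕ∞) → (∀ a → fin (g a) ≤∞ sum∞ (h a)) →
                          ∀ xs → fin (sum (map g xs)) ≤∞ sum∞ (concatMap h xs)
  sum-≤∞-sum∞-concatMap g h g≤h []       = z≤n
  sum-≤∞-sum∞-concatMap g h g≤h (x ∷ xs) =
    subst (fin (sum (map g (x ∷ xs))) ≤∞_) (sym (sum∞-++ (h x) (concatMap h xs)))
      (+∞-mono-≤∞ (sum∞ (h x)) _ (g≤h x) (sum-≤∞-sum∞-concatMap g h g≤h xs))

  foldr-min∞-≤∞ : ∀ {k} (f : A → ℕ∞) (p : A → Bool) → (∀ a → p a ≡ true → fin k ≤∞ f a) →
                  ∀ xs → fin k ≤∞ foldr (λ a m → min∞ (f a) m) ∞ (filterᵇ p xs)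
  foldr-min∞-≤∞ f p k≤f []       = tt
  foldr-min∞-≤∞ f p k≤f (x ∷ xs) with p x in px
  ... | true  = min∞-glb (f x) _ (k≤f x px) (foldr-min∞-≤∞ f p k≤f xs)
  ... | false = foldr-min∞-≤∞ f p k≤f xs

module _ {A : Set} (p : A → Bool) where

  sum-map-if : ∀ a b xs →
    sum (map (λ x → if p x then a else b) xs) ≡
      length (filterᵇ p xs) * a + length (filterᵇ (not ∘ p) xs) * b
  sum-map-if a b []       = refl
  sum-map-if a b (x ∷ xs) with p x
  ... | true  = trans (cong (a +_) (sum-map-if a b xs)) (sym (ℕ.+-assoc a (length (filterᵇ p xs) * a) _))
  ... | false = trans (cong (b +_) (sum-map-if a b xs)) (x∙yz≈y∙xz b (length (filterᵇ p xs) * a) _)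

  sum-map-indicator : ∀ xs → sum (map (λ x → if p x then 1 else 0) xs) ≡ length (filterᵇ p xs)
  sum-map-indicator xs = begin
    sum (map (λ x → if p x then 1 else 0) xs) ≡⟨ sum-map-if 1 0 xs ⟩
    #p * 1 + #¬p * 0                          ≡⟨ cong₂ _+_ (ℕ.*-identityʳ #p) (ℕ.*-zeroʳ #¬p) ⟩
    #p + 0                                    ≡⟨ ℕ.+-identityʳ #p ⟩
    #p                                        ∎
    where
      open ≡-Reasoning
      #p = length (filterᵇ p xs)
      #¬p = length (filterᵇ (not ∘ p) xs)

parity-suc : ∀ n → parity (suc n) ≡ parity n ⁻¹
parity-suc n = sym (suc-homo-⁻¹ (suc n))

parity-∣signℤ+∣ : ∀ s z → parity ∣ signℤ s ℤ.+ z ∣ ≡ parity ∣ z ∣ ⁻¹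
parity-∣signℤ+∣ Sign.+ (ℤ.+ n)        = parity-suc n
parity-∣signℤ+∣ Sign.+ ℤ.-[1+ zero ]  = refl
parity-∣signℤ+∣ Sign.+ ℤ.-[1+ suc n ] = parity-suc n
parity-∣signℤ+∣ Sign.- (ℤ.+ zero)     = refl
parity-∣signℤ+∣ Sign.- (ℤ.+ suc n)    = sym (suc-homo-⁻¹ n)
parity-∣signℤ+∣ Sign.- ℤ.-[1+ n ]     = sym (suc-homo-⁻¹ n)

⁻¹-+ : ∀ p q → p ⁻¹ ℙ.+ q ≡ (p ℙ.+ q) ⁻¹
⁻¹-+ 0ℙ q = refl
⁻¹-+ 1ℙ q = sym (⁻¹-involutive q)

fromBool : Bool → Parity
fromBool false = 0ℙ
fromBool true  = 1ℙ

fromBool-≢ : ∀ {a b} → a ≢ b → fromBool b ≡ fromBool a ⁻¹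
fromBool-≢ {false} {false} a≢b with () ← a≢b refl
fromBool-≢ {false} {true}  _   = refl
fromBool-≢ {true}  {false} _   = refl
fromBool-≢ {true}  {true}  a≢b with () ← a≢b refl

xor≡true⇒≢ : ∀ {a b} → a xor b ≡ true → a ≢ b
xor≡true⇒≢ {a} eq refl with () ← trans (sym eq) (xor-same a)

module _ {n : ℕ} (G : Graph n) where

  parity-∣σP∣ : (σ : Signing G) → ∀ x xs → parity ∣ σP G σ (x ∷ xs) ∣ ≡ parity (length xs)
  parity-∣σP∣ σ x []       = refl
  parity-∣σP∣ σ x (y ∷ ys) = begin
    parity ∣ signℤ (sgn σ x y) ℤ.+ σP G σ (y ∷ ys) ∣ ≡⟨ parity-∣signℤ+∣ (sgn σ x y) _ ⟩
    parity ∣ σP G σ (y ∷ ys) ∣ ⁻¹                    ≡⟨ cong _⁻¹ (parity-∣σP∣ σ y ys) ⟩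
    parity (length ys) ⁻¹                            ≡⟨ parity-suc (length ys) ⟨
    parity (length (y ∷ ys))                         ∎
    where open ≡-Reasoning

  IsProperColouring : (Fin n → Parity) → Set
  IsProperColouring c = ∀ u v → adj G u v ≡ true → c v ≡ c u ⁻¹

  parity-length-walk : ∀ {c} → IsProperColouring c → ∀ x xs → isWalk G (x ∷ xs) ≡ true →
                       parity (length xs) ≡ c x ℙ.+ c (lastOr G x xs)
  parity-length-walk {c} proper x []       _ = sym (p+p≡0ℙ (c x))
  -- Clauses omitted below are those in which a Boolean hypothesis has become false ≡ true.
  parity-length-walk {c} proper x (y ∷ ys) walk with adj G x y in xy
  ... | true = begin
    parity (suc (length ys)) ≡⟨ parity-suc (length ys) ⟩
    parity (length ys) ⁻¹    ≡⟨ cong _⁻¹ (parity-length-walk proper y ys walk) ⟩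
    (c y ℙ.+ c last) ⁻¹      ≡⟨ ⁻¹-+ (c y) (c last) ⟨
    c y ⁻¹ ℙ.+ c last        ≡⟨ cong (λ p → p ⁻¹ ℙ.+ c last) (proper x y xy) ⟩
    c x ⁻¹ ⁻¹ ℙ.+ c last     ≡⟨ cong (ℙ._+ c last) (⁻¹-involutive (c x)) ⟩
    c x ℙ.+ c last           ∎
    where
      open ≡-Reasoning
      last = lastOr G y ys

  ∣σP∣-pos-between-colours : ∀ {c} → IsProperColouring c → (σ : Signing G) →
    ∀ u v P → isPath G u v P ≡ true → c v ≡ c u ⁻¹ → 1 ≤ ∣ σP G σ P ∣
  ∣σP∣-pos-between-colours {c} proper σ u v (x ∷ xs) path cv
    with x ≟ u | lastOr G x xs ≟ v | isWalk G (x ∷ xs) in walk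
  ... | yes refl | yes refl | true = odd⇒1≤ (begin
    parity ∣ σP G σ (x ∷ xs) ∣ ≡⟨ parity-∣σP∣ σ x xs ⟩
    parity (length xs)         ≡⟨ parity-length-walk proper x xs walk ⟩
    c x ℙ.+ c v                ≡⟨ cong (c x ℙ.+_) cv ⟩
    c x ℙ.+ c x ⁻¹             ≡⟨ p+p⁻¹≡1ℙ (c x) ⟩
    1ℙ                         ∎)
    where
      open ≡-Reasoning
      odd⇒1≤ : ∀ {m} → parity m ≡ 1ℙ → 1 ≤ m
      odd⇒1≤ {suc m} _ = s≤s z≤n

  dσ-pos-between-colours : ∀ {c} → IsProperColouring c → (σ : Signing G) →
    ∀ u v → c v ≡ c u ⁻¹ → fin 1 ≤∞ dσ G σ u v
  dσ-pos-between-colours proper σ u v cv = foldr-min∞-≤∞ (λ P → fin ∣ σP G σ P ∣) (isPath G u v)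
    (λ P path → ∣σP∣-pos-between-colours proper σ u v P path cv) (candidates G)

  bipartition-isProperColouring : ∀ {part} → IsBipartition G part → IsProperColouring (fromBool ∘ part)
  bipartition-isProperColouring bip x y xy = fromBool-≢ (bip x y xy)

module _ {n : ℕ} (part : Fin n → Bool) where

  crossing : Fin n → Fin n → ℕ
  crossing u v = if part u xor part v then 1 else 0

  crossings-from : Fin n → ℕ
  crossings-from u = sum (map (crossing u) (allFin n))

  crossings-from≡ : ∀ u → crossings-from u ≡ (if part u then sizeV part else sizeU part)
  crossings-from≡ u with part u
  ... | true  = sum-map-indicator (not ∘ part) (allFin n)
  ... | false = sum-map-indicator part (allFin n)

  crossings≡ : sum (map crossings-from (allFin n)) ≡ sizeU part * sizeV part * 2
  crossings≡ = begin
    sum (map crossings-from (allFin n))                  ≡⟨ cong sum (map-cong crossings-from≡ (allFin n)) ⟩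
    sum (map (λ u → if part u then V else U) (allFin n)) ≡⟨ sum-map-if part V U (allFin n) ⟩
    U * V + V * U                                        ≡⟨ cong (U * V +_) (ℕ.*-comm V U) ⟩
    U * V + U * V                                        ≡⟨ cong (U * V +_) (ℕ.+-identityʳ (U * V)) ⟨
    2 * (U * V)                                          ≡⟨ ℕ.*-comm 2 (U * V) ⟩
    U * V * 2                                            ∎
    where
      open ≡-Reasoning
      U = sizeU part
      V = sizeV part

module _ {n : ℕ} (G : Graph n) {part : Fin n → Bool} (bip : IsBipartition G part) (σ : Signing G) where

  crossing-≤∞-dσ : ∀ u v → fin (crossing part u v) ≤∞ dσ G σ u v
  crossing-≤∞-dσ u v with part u xor part v in across
  ... | true  = dσ-pos-between-colours G (bipartition-isProperColouring G bip) σ u v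
                  (fromBool-≢ (xor≡true⇒≢ across))
  ... | false = 0≤∞ (dσ G σ u v)

  crossings-≤∞-sum∞-dσ : fin (sum (map (crossings-from part) (allFin n))) ≤∞
                          sum∞ (concatMap (λ u → map (λ v → dσ G σ u v) (allFin n)) (allFin n))
  crossings-≤∞-sum∞-dσ = sum-≤∞-sum∞-concatMap (crossings-from part) (λ u → map (dσ G σ u) (allFin n))
    (λ u → sum-≤∞-sum∞ (crossing part u) (dσ G σ u) (crossing-≤∞-dσ u) (allFin n)) (allFin n)

lemma3p1 : {n : ℕ} (G : Graph n) (part : Fin n → Bool) → IsBipartition G part →
    (σ : Signing G) → fin (sizeU part * sizeV part) ≤∞ Wσ G σ
lemma3p1 G part bip σ = ≤∞-half∞ (sizeU part * sizeV part) _
  (subst (λ t → fin t ≤∞ _) (crossings≡ part) (crossings-≤∞-sum∞-dσ G bip σ))
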